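{- Let $h\ge 3$ be an integer. Let $A=\{a_1,a_2,\ldots,a_k\}$ be an arithmetic progression of $k\ge h+1$ integers with common difference $d$, where $0<a_1<a_2<\cdots<a_k$. Then $$\left|h^{\wedge}_{\pm}A\right|\ge\begin{cases}2hk-h^2+1,& \text{if } d=2a_1,\\ 2hk-h^2+2,&\text{otherwise.}\end{cases}$$ Furthermore, $\left|h^{\wedge}_{\pm}A\right|=2hk-h^2+1$ if and only if $d=2\min(A)$.
   Context: For a positive integer $h$ and a finite set of integers $A=\{a_1,\ldots,a_k\}$ (distinct elements), the restricted $h$-fold signed sumset is $h^{\wedge}_{\pm}A=\left\{\sum_{i=1}^k\lambda_i a_i:\lambda_i\in\{ -1,0,1\},\ \sum_{i=1}^k|\lambda_i|=h\right\}$. -}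

module Defs where

open import Data.Nat as ℕ using (ℕ; zero; suc)
open import Data.Integer using (ℤ; +_; -_; _+_; _*_; ∣_∣)
import Data.Integer as ℤ
open import Data.Fin using (Fin; toℕ)
open import Data.List using (List; []; _∷_; [_]; map; concatMap; filter; length; deduplicate)
open import Data.Vec as Vec using (Vec; tabulate; zipWith)
import Data.Vec as V

signVectors : (k : ℕ) → List (Vec ℤ k)
signVectors zero = [ V.[] ]
signVectors (suc k) =
  concatMap (λ v → map (V._∷ v) (ℤ.-1ℤ ∷ ℤ.0ℤ ∷ ℤ.1ℤ ∷ [])) (signVectors k)

weight : {k : ℕ} → Vec ℤ k → ℕ
weight v = V.foldr _ (λ x n → ∣ x ∣ ℕ.+ n) 0 v

dot : {k : ℕ} → Vec ℤ k → Vec ℤ k → ℤ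
dot lam a = V.foldr _ _+_ (+ 0) (zipWith _*_ lam a)

-- The restricted h-fold signed sumset h^∧_± A, as a list (possibly with repetitions)
-- of all sums Σ λᵢ aᵢ with λᵢ ∈ {-1,0,1} and Σ|λᵢ| = h.
restrictedSignedSumset : (h : ℕ) {k : ℕ} → Vec ℤ k → List ℤ
restrictedSignedSumset h {k} a =
  map (λ lam → dot lam a) (filter (λ lam → weight lam ℕ.≟ h) (signVectors k))

card : List ℤ → ℕ
card xs = length (deduplicate ℤ._≟_ xs)

ap : ℤ → ℤ → (k : ℕ) → Vec ℤ k
ap a₁ d k = tabulate (λ i → a₁ + (+ toℕ i) * d)

-- Write A = (a + i d)_{i<k} and r = k − h ≥ 1.  A signed sum with p plus and q minus signs
-- (p + q = h) equals (p − q) a + β d with β = Σ₊ i − Σ₋ i, and over all placements of the signs β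
-- fills an interval of length 2pq + (p + q) r, missing one value only when p = q = 1.  Taking, for
-- p = 0, …, h − 1, the first 2p + r + 1 values of β and then all values for p = h gives runs of sums
-- whose steps are d and in which each run ends exactly 2a below the start of the next: a strictly
-- increasing list of h(h + 2r) + 1 = 2hk − h² + 1 sums.  If d ≠ 2a, the sum one step d past the first
-- run lies strictly between two neighbours of that list.  If d = 2a, then A = {a, 3a, …, (2k − 1)a},
-- so every sum is a·m with m ≡ h(h + 2r) (mod 2) and |m| ≤ h(h + 2r): at most h(h + 2r) + 1 sums.
module Submission where

open import Data.Product using (∃-syntax; _×_; _,_)
open import Data.Sum using (_⊎_; inj₁; inj₂; [_,_]′)
open import Relation.Binary.PropositionalEquality
open import Relation.Nullary using (yes; no; ¬_; Dec)
open import Relation.Nullary.Decidable using (_×-dec_; toSum)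

module Offsets where
  open import Data.Nat
  open import Data.Nat.Properties
  open import Data.Nat.Tactic.RingSolver using (solve-∀)

  -- Offset p q r s: some placement of p plus signs, q minus signs and r blanks on the positions
  -- 0, …, p + q + r − 1 has Σ₊ i − Σ₋ i equal to its least possible value plus s.  Each constructor
  -- puts a new symbol at position 0 and moves the others up by one.
  data Offset : ℕ → ℕ → ℕ → ℕ → Set where
    []    : Offset 0 0 0 0
    skip  : ∀ {p q r s} → Offset p q r s → Offset p q (suc r) (p + s)
    plus  : ∀ {p q r s} → Offset p q r s → Offset (suc p) q r s
    minus : ∀ {p q r s} → Offset p q r s → Offset p (suc q) r (p + p + r + s)

  width : ℕ → ℕ → ℕ → ℕ
  width p q r = 2 * p * q + (p + q) * r

  width-skip : ∀ p q r → p + (2 * p * q + (p + q) * r + q) ≡ 2 * p * q + (p + q) * suc r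
  width-skip = solve-∀

  width-plus : ∀ p q r → 2 * p * q + (p + q) * r + (q + q + r) ≡ 2 * suc p * q + (suc p + q) * r
  width-plus = solve-∀

  width-minus : ∀ p q r → p + p + r + (2 * p * q + (p + q) * r) ≡ 2 * p * suc q + (p + suc q) * r
  width-minus = solve-∀

  width-fill : ∀ p q r → p * (p + r) + (2 * p * q + (p + q) * r) + q * (q + r) ≡ (p + q) * (p + q + 2 * r)
  width-fill = solve-∀

  offset-least : ∀ p q r → Offset p q r 0
  offset-least (suc p) q       r       = plus (offset-least p q r)
  offset-least zero    q       (suc r) = skip (offset-least 0 q r)
  offset-least zero    (suc q) zero    = minus (offset-least 0 q 0)
  offset-least zero    zero    zero    = []

  offset≤width : ∀ {p q r s} → Offset p q r s → s ≤ width p q r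
  offset≤width [] = z≤n
  offset≤width (skip {p} {q} {r} {s} o) =
    subst (p + s ≤_) (width-skip p q r) (+-monoʳ-≤ p (m≤n⇒m≤n+o q (offset≤width o)))
  offset≤width (plus {p} {q} {r} {s} o) =
    subst (s ≤_) (width-plus p q r) (m≤n⇒m≤n+o (q + q + r) (offset≤width o))
  offset≤width (minus {p} {q} {r} {s} o) =
    subst (p + p + r + s ≤_) (width-minus p q r) (+-monoʳ-≤ (p + p + r) (offset≤width o))

  -- An eliminator rather than a sum, so that offset-interval recurses without `with`, which would
  -- hide its recursive calls from the termination checker.
  ≤-cover : ∀ A B C {s} (P : ℕ → Set) → (A < s → B ≤ s) → s ≤ B + C →
            (s ≤ A → P s) → (∀ {t} → t ≤ C → P (B + t)) → P s
  ≤-cover A B C {s} P B≤s s≤B+C below above with s ≤? A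
  ... | yes s≤A = below s≤A
  ... | no s≰A with B≤s ← B≤s (≰⇒> s≰A) =
    subst P (m+[n∸m]≡n B≤s) (above (m≤n+o⇒m∸n≤o s B s≤B+C))

  private
    width-q0 : ∀ p r → 2 * p * 0 + (p + 0) * r ≡ p * r
    width-q0 = solve-∀
    width-p0 : ∀ q r → 2 * 0 * q + (0 + q) * r ≡ q * r
    width-p0 = solve-∀
    width-q0-r0 : ∀ p → 2 * p * 0 + (p + 0) * 0 ≡ 0
    width-q0-r0 = solve-∀
    width-p0-r0 : ∀ q → 2 * 0 * q + (0 + q) * 0 ≡ 0
    width-p0-r0 = solve-∀
    width-11 : ∀ r → 2 * 0 * 1 + (0 + 1) * suc r ≡ suc r
    width-11 = solve-∀
    split-plus-skip : ∀ p r →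
      2 * suc p * 0 + (suc p + 0) * suc r ≡ suc p + (2 * suc p * 0 + (suc p + 0) * r)
    split-plus-skip = solve-∀
    split-minus-skip : ∀ q r →
      2 * 0 * suc q + (0 + suc q) * suc r ≡ suc r + (2 * 0 * q + (0 + q) * suc r)
    split-minus-skip = solve-∀
    split-plus-minus : ∀ p q r → 2 * suc p * suc q + (suc p + suc q) * suc r
                               ≡ suc p + suc p + suc r + (2 * suc p * q + (suc p + q) * suc r)
    split-plus-minus = solve-∀
    meet-suc-p : ∀ p q r → suc (suc p) + suc (suc p) + suc r + (3 * q + 2 * p * q + p + r + p * r + q * r)
                         ≡ suc (2 * suc p * suc q + (suc p + suc q) * suc r)
    meet-suc-p = solve-∀
    meet-suc-q : ∀ q r → 3 + r + (r + q + q * r) ≡ suc (2 * 0 * suc (suc q) + (0 + suc (suc q)) * suc r)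
    meet-suc-q = solve-∀

  plus-minus-meet : ∀ p q r {s} → (suc p ≡ 1 → suc q ≡ 1 → s ≢ suc (suc r)) →
                    width p (suc q) (suc r) < s → suc p + suc p + suc r ≤ s
  plus-minus-meet zero    zero    r {s} hole A<s =
    ≤∧≢⇒< (subst (_< s) (width-11 r) A<s) (λ eq → hole refl refl (sym eq))
  plus-minus-meet (suc p) q       r _ A<s = ≤-trans (≤″⇒≤ record { equality = meet-suc-p p q r }) A<s
  plus-minus-meet zero    (suc q) r _ A<s = ≤-trans (≤″⇒≤ record { equality = meet-suc-q q r }) A<s

  -- The two offsets that the generic case of offset-interval would reach only through the hole of
  -- Offset 1 1.
  offset₂₁ : ∀ r → Offset 2 1 r r
  offset₂₁ r = plus (plus (subst (Offset 0 1 r) (+-identityʳ r) (minus (offset-least 0 0 r))))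

  offset₁₂ : ∀ r → Offset 1 2 r (2 + r + (2 + r))
  offset₁₂ r =
    subst (Offset 1 2 r) (cong (2 + r +_) (+-identityʳ (2 + r))) (minus (minus (offset-least 1 0 r)))

  -- Without blanks and with both signs present only every second offset occurs; with one sign of
  -- each kind, the difference of two distinct positions is never 0.
  offset-interval : ∀ p q r {s} → 1 ≤ r ⊎ p ≡ 0 ⊎ q ≡ 0 → (p ≡ 1 → q ≡ 1 → s ≢ suc r) →
                    s ≤ width p q r → Offset p q r s
  offset-interval p q r {zero} _ _ _ = offset-least p q r
  offset-interval zero zero r {suc s} _ _ ()
  offset-interval (suc p) zero zero {suc s} _ _ s≤ with () ← subst (suc s ≤_) (width-q0-r0 (suc p)) s≤
  offset-interval zero (suc q) zero {suc s} _ _ s≤ with () ← subst (suc s ≤_) (width-p0-r0 (suc q)) s≤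
  offset-interval (suc p) zero (suc r) {s} _ _ s≤ =
    ≤-cover (width p 0 (suc r)) (suc p) (width (suc p) 0 r) (Offset (suc p) 0 (suc r))
      (≤-trans (s≤s (subst (p ≤_) (sym (width-q0 p (suc r))) (m≤m*n p (suc r)))))
      (subst (s ≤_) (split-plus-skip p r) s≤)
      (λ s≤A → plus (offset-interval p 0 (suc r) (inj₂ (inj₂ refl)) (λ _ ()) s≤A))
      (λ t≤C → skip (offset-interval (suc p) 0 r (inj₂ (inj₂ refl)) (λ _ ()) t≤C))
  offset-interval zero (suc q) (suc r) {s} _ _ s≤ =
    ≤-cover (width 0 (suc q) r) (suc r) (width 0 q (suc r)) (Offset 0 (suc q) (suc r))
      (≤-trans (s≤s (subst (r ≤_) (sym (width-p0 (suc q) r)) (m≤n*m r (suc q)))))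
      (subst (s ≤_) (split-minus-skip q r) s≤)
      (λ s≤A → skip (offset-interval 0 (suc q) r (inj₂ (inj₁ refl)) (λ ()) s≤A))
      (λ t≤C → minus (offset-interval 0 q (suc r) (inj₂ (inj₁ refl)) (λ ()) t≤C))
  offset-interval (suc p) (suc q) zero (inj₁ ())
  offset-interval (suc p) (suc q) zero (inj₂ (inj₁ ()))
  offset-interval (suc p) (suc q) zero (inj₂ (inj₂ ()))
  offset-interval (suc p) (suc q) (suc r) {s} _ hole s≤ =
    ≤-cover (width p (suc q) (suc r)) (suc p + suc p + suc r) (width (suc p) q (suc r))
            (Offset (suc p) (suc q) (suc r))
      (plus-minus-meet p q r hole) (subst (s ≤_) (split-plus-minus p q r) s≤)
      (λ s≤A → [ (λ { (refl , refl , refl) → skip (offset₂₁ r) })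
               , (λ ¬hole → plus (offset-interval p (suc q) (suc r) (inj₁ (s≤s z≤n))
                                    (λ { refl refl refl → ¬hole (refl , refl , refl) }) s≤A))
               ]′ (toSum (p ≟ 1 ×-dec q ≟ 0 ×-dec s ≟ suc (suc r))))
      (λ {t} t≤C → [ (λ { (refl , refl , refl) → skip (offset₁₂ r) })
                   , (λ ¬hole → minus (offset-interval (suc p) q (suc r) (inj₁ (s≤s z≤n))
                                         (λ { refl refl refl → ¬hole (refl , refl , refl) }) t≤C))
                   ]′ (toSum (p ≟ 0 ×-dec q ≟ 1 ×-dec t ≟ suc (suc r))))

open Offsets

open import Defs
open import Data.Nat using (ℕ; zero; suc; z≤n; s≤s; _≤_; _≥_; _∸_)
import Data.Nat as ℕ
import Data.Nat.Properties as ℕ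
import Data.Nat.Tactic.RingSolver as ℕ-Solver
open import Data.Integer as ℤ using (ℤ; +_; -_; _+_; _-_; _*_; 0ℤ; 1ℤ; -1ℤ; _<_)
import Data.Integer.Properties as ℤ
open import Data.Integer.Tactic.RingSolver using (solve-∀)
open import Algebra.Bundles using (AbelianGroup)
open import Algebra.Properties.Group (AbelianGroup.group ℤ.+-0-abelianGroup)
  using () renaming (∙-cancelˡ to +-cancelˡ)
open import Data.Empty using (⊥-elim)
open import Data.Fin using (toℕ)
open import Data.Vec as Vec using (Vec; []; _∷_)
import Data.Vec.Properties as Vec
open import Data.List using (List; []; _∷_; map; length; upTo; _++_)
import Data.List.Properties as List
open import Data.List.Membership.Propositional using (_∈_; find)
open import Data.List.Membership.Propositional.Properties
open import Data.List.Relation.Binary.Subset.Propositional using (_⊆_)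
open import Data.List.Relation.Unary.Any as Any using (here; there)
open import Data.List.Relation.Unary.All as All using (All; []; _∷_)
import Data.List.Relation.Unary.All.Properties as All
open import Data.List.Relation.Unary.AllPairs as AllPairs using (AllPairs; []; _∷_)
import Data.List.Relation.Unary.AllPairs.Properties as AllPairs
open import Data.List.Relation.Unary.Unique.Propositional using (Unique)
open import Data.List.Relation.Unary.Unique.DecPropositional.Properties ℤ._≟_ using (deduplicate-!)
open import Function.Bundles using (_⇔_; mk⇔)

data SignedSum : ℕ → {k : ℕ} → Vec ℤ k → ℤ → Set where
  []    : SignedSum 0 [] 0ℤ
  skip  : ∀ {h k x v} {xs : Vec ℤ k} → SignedSum h xs v → SignedSum h (x ∷ xs) v
  plus  : ∀ {h k x v} {xs : Vec ℤ k} → SignedSum h xs v → SignedSum (suc h) (x ∷ xs) (x + v)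
  minus : ∀ {h k x v} {xs : Vec ℤ k} → SignedSum h xs v → SignedSum (suc h) (x ∷ xs) (- x + v)

signs : List ℤ
signs = -1ℤ ∷ 0ℤ ∷ 1ℤ ∷ []

∷-∈-signVectors : ∀ {k c} {cs : Vec ℤ k} → c ∈ signs → cs ∈ signVectors k →
                  (c ∷ cs) ∈ signVectors (suc k)
∷-∈-signVectors {cs = cs} c∈ cs∈ =
  ∈-concatMap⁺ (λ v → map (Vec._∷ v) signs) (Any.map (λ { refl → ∈-map⁺ (Vec._∷ cs) c∈ }) cs∈)

signedSum⇒coefficients : ∀ {h k v} {xs : Vec ℤ k} → SignedSum h xs v →
                         ∃[ cs ] cs ∈ signVectors k × weight cs ≡ h × dot cs xs ≡ v
signedSum⇒coefficients [] = [] , here refl , refl , refl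
signedSum⇒coefficients (skip σ) with cs , cs∈ , refl , refl ← signedSum⇒coefficients σ =
  0ℤ ∷ cs , ∷-∈-signVectors (there (here refl)) cs∈ , refl , ℤ.+-identityˡ _
signedSum⇒coefficients (plus {x = x} σ) with cs , cs∈ , refl , refl ← signedSum⇒coefficients σ =
  1ℤ ∷ cs , ∷-∈-signVectors (there (there (here refl))) cs∈ , refl , cong (_+ dot cs _) (ℤ.*-identityˡ x)
signedSum⇒coefficients (minus {x = x} σ) with cs , cs∈ , refl , refl ← signedSum⇒coefficients σ =
  -1ℤ ∷ cs , ∷-∈-signVectors (here refl) cs∈ , refl , cong (_+ dot cs _) (ℤ.-1*i≡-i x)

coefficients⇒signedSum : ∀ {k} (xs : Vec ℤ k) {cs} → cs ∈ signVectors k →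
                         SignedSum (weight cs) xs (dot cs xs)
coefficients⇒signedSum [] (here refl) = []
coefficients⇒signedSum {suc k} (x ∷ xs) c∷cs∈
  with cs , cs∈ , c∷cs∈map ←
         find (∈-concatMap⁻ (λ v → map (Vec._∷ v) signs) {xs = signVectors k} c∷cs∈)
  with ∈-map⁻ (Vec._∷ cs) c∷cs∈map
... | _ , here refl , refl =
  subst (SignedSum _ _) (cong (_+ dot cs xs) (sym (ℤ.-1*i≡-i x))) (minus (coefficients⇒signedSum xs cs∈))
... | _ , there (here refl) , refl =
  subst (SignedSum _ _) (sym (ℤ.+-identityˡ _)) (skip (coefficients⇒signedSum xs cs∈))
... | _ , there (there (here refl)) , refl =
  subst (SignedSum _ _) (cong (_+ dot cs xs) (sym (ℤ.*-identityˡ x))) (plus (coefficients⇒signedSum xs cs∈))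

signedSum⇒∈ : ∀ {h k v} {xs : Vec ℤ k} → SignedSum h xs v → v ∈ restrictedSignedSumset h xs
signedSum⇒∈ {h} {xs = xs} σ with cs , cs∈ , w≡h , refl ← signedSum⇒coefficients σ =
  ∈-map⁺ (λ cs → dot cs xs) (∈-filter⁺ (λ cs → weight cs ℕ.≟ h) cs∈ w≡h)

∈⇒signedSum : ∀ {h k v} {xs : Vec ℤ k} → v ∈ restrictedSignedSumset h xs → SignedSum h xs v
∈⇒signedSum {h} {k} {xs = xs} v∈ with cs , cs∈ , refl ← ∈-map⁻ (λ cs → dot cs xs) v∈
  with cs∈ , refl ← ∈-filter⁻ (λ cs → weight cs ℕ.≟ h) {xs = signVectors k} cs∈ =
  coefficients⇒signedSum xs cs∈

length-mono-⊆ : ∀ {xs ys : List ℤ} → Unique xs → xs ⊆ ys → length xs ≤ length ys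
length-mono-⊆ {[]} _ _ = z≤n
length-mono-⊆ {x ∷ xs} (x∉xs ∷ xs!) xs⊆ys with us , ws , refl ← ∈-∃++ (xs⊆ys (here refl)) =
  ℕ.≤-trans (s≤s (length-mono-⊆ xs! xs⊆us++ws)) (ℕ.≤-reflexive length-removal)
  where
  xs⊆us++ws : xs ⊆ us ++ ws
  xs⊆us++ws y∈xs with ∈-++⁻ us (xs⊆ys (there y∈xs))
  ... | inj₁ y∈us = ∈-++⁺ˡ y∈us
  ... | inj₂ (here refl) = ⊥-elim (All.lookup x∉xs y∈xs refl)
  ... | inj₂ (there y∈ws) = ∈-++⁺ʳ us y∈ws
  length-removal : suc (length (us ++ ws)) ≡ length (us ++ x ∷ ws)
  length-removal = begin
    suc (length (us ++ ws))        ≡⟨ cong suc (List.length-++ us) ⟩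
    suc (length us ℕ.+ length ws)  ≡⟨ ℕ.+-suc (length us) (length ws) ⟨
    length us ℕ.+ length (x ∷ ws)  ≡⟨ List.length-++ us ⟨
    length (us ++ x ∷ ws)          ∎
    where open ≡-Reasoning

length≤card : ∀ {xs ys} → Unique xs → xs ⊆ ys → length xs ≤ card ys
length≤card xs! xs⊆ys = length-mono-⊆ xs! (λ x∈ → ∈-deduplicate⁺ ℤ._≟_ (xs⊆ys x∈))

card≤length : ∀ {xs ys} → xs ⊆ ys → card xs ≤ length ys
card≤length {xs} xs⊆ys =
  length-mono-⊆ (deduplicate-! xs) (λ x∈ → xs⊆ys (∈-deduplicate⁻ ℤ._≟_ xs x∈))

head-≤ : ∀ {x xs} → AllPairs _<_ (x ∷ xs) → All (x ℤ.≤_) (x ∷ xs)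
head-≤ (x<xs ∷ _) = ℤ.≤-refl ∷ All.map ℤ.<⇒≤ x<xs

between-∉ : ∀ {e x y ys} → AllPairs _<_ (x ∷ y ∷ ys) → e ≢ x → e < y → All (e ≢_) (x ∷ y ∷ ys)
between-∉ (_ ∷ y<ys ∷ _) e≢x e<y =
  e≢x ∷ ℤ.<⇒≢ e<y ∷ All.map (λ y<z → ℤ.<⇒≢ (ℤ.<-trans e<y y<z)) y<ys

i<i+j : ∀ i {j} → 0ℤ < j → i < i + j
i<i+j i {j} 0<j = subst (_< i + j) (ℤ.+-identityʳ i) (ℤ.+-monoʳ-< i 0<j)

apFrom : ℤ → ℤ → (k : ℕ) → Vec ℤ k
apFrom x d zero    = []
apFrom x d (suc k) = x ∷ apFrom (x + d) d k

private
  ap-head : ∀ x d → x + + 0 * d ≡ x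
  ap-head = solve-∀
  ap-tail : ∀ x d n → x + (1ℤ + n) * d ≡ (x + d) + n * d
  ap-tail = solve-∀

ap≡apFrom : ∀ x d k → ap x d k ≡ apFrom x d k
ap≡apFrom x d zero    = refl
ap≡apFrom x d (suc k) = cong₂ _∷_ (ap-head x d)
  (trans (Vec.tabulate-cong (λ i → ap-tail x d (+ toℕ i))) (ap≡apFrom (x + d) d k))

triangle : ℕ → ℤ
triangle zero    = 0ℤ
triangle (suc n) = triangle n + + n

-- Σ₊ i − Σ₋ i for the plus signs on the first p positions and the minus signs on the last q.
least : ℕ → ℕ → ℕ → ℤ
least p q r = triangle p - triangle q - + q * (+ p + + r)

value : ℤ → ℤ → ℕ → ℕ → ℕ → ℕ → ℤ
value x d p q r s = (+ p - + q) * x + (least p q r + + s) * d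

private
  skip-ring : ∀ x d P Q R S Tp Tq →
    (P - Q) * x + (Tp - Tq - Q * (P + (1ℤ + R)) + (P + S)) * d
    ≡ (P - Q) * (x + d) + (Tp - Tq - Q * (P + R) + S) * d
  skip-ring = solve-∀
  plus-ring : ∀ x d P Q R S Tp Tq →
    (1ℤ + P - Q) * x + ((Tp + P) - Tq - Q * ((1ℤ + P) + R) + S) * d
    ≡ x + ((P - Q) * (x + d) + (Tp - Tq - Q * (P + R) + S) * d)
  plus-ring = solve-∀
  minus-ring : ∀ x d P Q R S Tp Tq →
    (P - (1ℤ + Q)) * x + (Tp - (Tq + Q) - (1ℤ + Q) * (P + R) + (P + P + R + S)) * d
    ≡ - x + ((P - Q) * (x + d) + (Tp - Tq - Q * (P + R) + S) * d)
  minus-ring = solve-∀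

value-skip : ∀ x d p q r s → value x d p q (suc r) (p ℕ.+ s) ≡ value (x + d) d p q r s
value-skip x d p q r s = skip-ring x d (+ p) (+ q) (+ r) (+ s) (triangle p) (triangle q)

value-plus : ∀ x d p q r s → value x d (suc p) q r s ≡ x + value (x + d) d p q r s
value-plus x d p q r s = plus-ring x d (+ p) (+ q) (+ r) (+ s) (triangle p) (triangle q)

value-minus : ∀ x d p q r s → value x d p (suc q) r (p ℕ.+ p ℕ.+ r ℕ.+ s) ≡ - x + value (x + d) d p q r s
value-minus x d p q r s = minus-ring x d (+ p) (+ q) (+ r) (+ s) (triangle p) (triangle q)

private
  shift-ring : ∀ a d P Q L S T → (P - Q) * a + (L + (S + T)) * d ≡ ((P - Q) * a + (L + S) * d) + T * d
  shift-ring = solve-∀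
  step-ring : ∀ a d P Q L S → (P - Q) * a + (L + (1ℤ + S)) * d ≡ ((P - Q) * a + (L + S) * d) + d
  step-ring = solve-∀
  flip-ring : ∀ a d P Q R Tp Tq →
    (1ℤ + P - Q) * a + ((Tp + P) - Tq - Q * ((1ℤ + P) + R) + + 0) * d
    ≡ ((P - (1ℤ + Q)) * a + (Tp - (Tq + Q) - (1ℤ + Q) * (P + R) + (P + P + R)) * d) + + 2 * a
  flip-ring = solve-∀

value-+ : ∀ a d p q r s t → value a d p q r (s ℕ.+ t) ≡ value a d p q r s + + t * d
value-+ a d p q r s t = shift-ring a d (+ p) (+ q) (least p q r) (+ s) (+ t)

value-suc : ∀ a d p q r s → value a d p q r (suc s) ≡ value a d p q r s + d
value-suc a d p q r s = step-ring a d (+ p) (+ q) (least p q r) (+ s)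

value-flip : ∀ a d p q r → value a d (suc p) q r 0 ≡ value a d p (suc q) r (p ℕ.+ p ℕ.+ r) + + 2 * a
value-flip a d p q r = flip-ring a d (+ p) (+ q) (+ r) (triangle p) (triangle q)

offset⇒signedSum : ∀ d {p q r s} → Offset p q r s → ∀ x →
                   SignedSum (p ℕ.+ q) (apFrom x d (p ℕ.+ q ℕ.+ r)) (value x d p q r s)
offset⇒signedSum d [] x = []
offset⇒signedSum d (skip {p} {q} {r} {s} o) x rewrite ℕ.+-suc (p ℕ.+ q) r =
  subst (SignedSum _ _) (sym (value-skip x d p q r s)) (skip (offset⇒signedSum d o (x + d)))
offset⇒signedSum d (plus {p} {q} {r} {s} o) x =
  subst (SignedSum _ _) (sym (value-plus x d p q r s)) (plus (offset⇒signedSum d o (x + d)))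
offset⇒signedSum d (minus {p} {q} {r} {s} o) x rewrite ℕ.+-suc p q =
  subst (SignedSum _ _) (sym (value-minus x d p q r s)) (minus (offset⇒signedSum d o (x + d)))

signedSum⇒offset : ∀ d {h k v} x → SignedSum h (apFrom x d k) v →
  ∃[ p ] ∃[ q ] ∃[ r ] ∃[ s ]
    Offset p q r s × p ℕ.+ q ≡ h × p ℕ.+ q ℕ.+ r ≡ k × v ≡ value x d p q r s
signedSum⇒offset d {k = zero} x [] = 0 , 0 , 0 , 0 , [] , refl , refl , refl
signedSum⇒offset d {k = suc k} x (skip σ)
  with p , q , r , s , o , refl , refl , refl ← signedSum⇒offset d (x + d) σ =
  p , q , suc r , p ℕ.+ s , skip o , refl , ℕ.+-suc (p ℕ.+ q) r , sym (value-skip x d p q r s)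
signedSum⇒offset d {k = suc k} x (plus σ)
  with p , q , r , s , o , refl , refl , refl ← signedSum⇒offset d (x + d) σ =
  suc p , q , r , s , plus o , refl , refl , sym (value-plus x d p q r s)
signedSum⇒offset d {k = suc k} x (minus σ)
  with p , q , r , s , o , refl , refl , refl ← signedSum⇒offset d (x + d) σ =
  p , suc q , r , p ℕ.+ p ℕ.+ r ℕ.+ s , minus o ,
  ℕ.+-suc p q , cong (ℕ._+ r) (ℕ.+-suc p q) , sym (value-minus x d p q r s)

private
  triangle-ring : ∀ T N → (T + N) + (T + N) ≡ (T + T) + (N + N)
  triangle-ring = solve-∀
  square-ring : ∀ N → (N * N - N) + (N + N) ≡ (1ℤ + N) * (1ℤ + N) - (1ℤ + N)
  square-ring = solve-∀

triangle-double : ∀ n → triangle n + triangle n ≡ + n * + n - + n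
triangle-double zero    = refl
triangle-double (suc n) = begin
  (triangle n + + n) + (triangle n + + n)   ≡⟨ triangle-ring (triangle n) (+ n) ⟩
  (triangle n + triangle n) + (+ n + + n)   ≡⟨ cong (_+ (+ n + + n)) (triangle-double n) ⟩
  (+ n * + n - + n) + (+ n + + n)           ≡⟨ square-ring (+ n) ⟩
  + suc n * + suc n - + suc n               ∎
  where open ≡-Reasoning

private
  doubled-ring : ∀ a P Q R S Tp Tq →
    (P - Q) * a + (Tp - Tq - Q * (P + R) + S) * (+ 2 * a)
    ≡ ((P - Q) + (Tp + Tp) - (Tq + Tq) - + 2 * Q * (P + R) + + 2 * S) * a
  doubled-ring = solve-∀
  squared-ring : ∀ a P Q R S →
    ((P - Q) + (P * P - P) - (Q * Q - Q) - + 2 * Q * (P + R) + + 2 * S) * a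
    ≡ a * (+ 2 * (P * (P + R) + S) - (P + Q) * (P + Q + + 2 * R))
  squared-ring = solve-∀

spread : ℕ → ℕ → ℕ
spread h r = h ℕ.* (h ℕ.+ 2 ℕ.* r)

value-double : ∀ a p q r s →
               value a (+ 2 * a) p q r s ≡ a * (+ 2 * + (p ℕ.* (p ℕ.+ r) ℕ.+ s) - + spread (p ℕ.+ q) r)
value-double a p q r s = begin
  value a (+ 2 * a) p q r s
    ≡⟨ doubled-ring a P Q R S (triangle p) (triangle q) ⟩
  (P - Q + (triangle p + triangle p) - (triangle q + triangle q) - + 2 * Q * (P + R) + + 2 * S) * a
    ≡⟨ cong₂ (λ u v → (P - Q + u - v - + 2 * Q * (P + R) + + 2 * S) * a)
             (triangle-double p) (triangle-double q) ⟩
  (P - Q + (P * P - P) - (Q * Q - Q) - + 2 * Q * (P + R) + + 2 * S) * a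
    ≡⟨ squared-ring a P Q R S ⟩
  a * (+ 2 * (P * (P + R) + S) - (P + Q) * (P + Q + + 2 * R))
    ≡⟨ cong₂ (λ u v → a * (+ 2 * (u + S) - v))
             (ℤ.pos-* p (p ℕ.+ r))
             (trans (ℤ.pos-* (p ℕ.+ q) _) (cong (λ z → + (p ℕ.+ q) * (P + Q + z)) (ℤ.pos-* 2 r))) ⟨
  a * (+ 2 * + (p ℕ.* (p ℕ.+ r) ℕ.+ s) - + spread (p ℕ.+ q) r)   ∎
  where
  open ≡-Reasoning
  P Q R S : ℤ
  P = + p
  Q = + q
  R = + r
  S = + s

signedSum-oddMultiple : ∀ a {h r v} → SignedSum h (apFrom a (+ 2 * a) (h ℕ.+ r)) v →
                        ∃[ j ] j ≤ spread h r × v ≡ a * (+ 2 * + j - + spread h r)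
signedSum-oddMultiple a {r = r} σ
  with p , q , r′ , s , o , refl , k≡ , refl ← signedSum⇒offset (+ 2 * a) a σ
  with refl ← ℕ.+-cancelˡ-≡ (p ℕ.+ q) r′ r k≡ =
  p ℕ.* (p ℕ.+ r) ℕ.+ s ,
  ℕ.≤-trans (ℕ.+-monoʳ-≤ (p ℕ.* (p ℕ.+ r)) (offset≤width o))
            (subst (p ℕ.* (p ℕ.+ r) ℕ.+ width p q r ≤_) (width-fill p q r) (ℕ.m≤m+n _ _)) ,
  value-double a p q r s

module Chain {a d : ℤ} (0<a : 0ℤ < a) (0<d : 0ℤ < d) (r : ℕ) where

  V : ℕ → ℕ → ℕ → ℤ
  V p q = value a d p q r

  0<2a : 0ℤ < + 2 * a
  0<2a = ℤ.*-monoˡ-<-pos (+ 2) 0<a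

  segmentEnd : ℕ → ℕ → ℕ
  segmentEnd p zero    = width p 0 r
  segmentEnd p (suc q) = p ℕ.+ p ℕ.+ r

  segment : ℕ → ℕ → List ℤ
  segment p q = map (V p q) (upTo (suc (segmentEnd p q)))

  chain : ℕ → ℕ → List ℤ
  chain p zero    = segment p zero
  chain p (suc q) = segment p (suc q) ++ chain (suc p) q

  V-mono : ∀ p q {s s′} → s ℕ.< s′ → V p q s < V p q s′
  V-mono p q {s} s<s′ with t , refl ← ℕ.m≤n⇒∃[o]m+o≡n s<s′ =
    subst (λ x → V p q s < V p q x) (ℕ.+-suc s t)
      (subst (V p q s <_) (sym (value-+ a d p q r s (suc t))) (i<i+j _ 0<td))
    where
    0<td : 0ℤ < + suc t * d
    0<td = subst (_< + suc t * d) (ℤ.*-zeroʳ (+ suc t)) (ℤ.*-monoˡ-<-pos (+ suc t) 0<d)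

  V-mono-≤ : ∀ p q {s s′} → s ≤ s′ → V p q s ℤ.≤ V p q s′
  V-mono-≤ p q s≤s′ with ℕ.m≤n⇒m<n∨m≡n s≤s′
  ... | inj₁ s<s′ = ℤ.<⇒≤ (V-mono p q s<s′)
  ... | inj₂ refl = ℤ.≤-refl

  segment-all : ∀ {P : ℤ → Set} p q → (∀ {s} → s ≤ segmentEnd p q → P (V p q s)) →
                All P (segment p q)
  segment-all p q P-V = All.map⁺ (All.applyUpTo⁺₁ _ _ (λ s< → P-V (ℕ.≤-pred s<)))

  segment-sorted : ∀ p q → AllPairs _<_ (segment p q)
  segment-sorted p q = AllPairs.map⁺ (AllPairs.applyUpTo⁺₁ _ _ (λ i<j _ → V-mono p q i<j))

  chain-sorted : ∀ p q → AllPairs _<_ (chain p q)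
  chain-sorted p zero    = segment-sorted p zero
  chain-sorted p (suc q) = AllPairs.++⁺ (segment-sorted p (suc q)) (chain-sorted (suc p) q)
    (segment-all p (suc q) (λ s≤ →
      All.map (ℤ.<-≤-trans (ℤ.≤-<-trans (V-mono-≤ p (suc q) s≤) end<next)) (chain-least (suc p) q)))
    where
    end<next : V p (suc q) (p ℕ.+ p ℕ.+ r) < V (suc p) q 0
    end<next = subst (V p (suc q) (p ℕ.+ p ℕ.+ r) <_) (sym (value-flip a d p q r)) (i<i+j _ 0<2a)
    chain-least : ∀ p q → All (V p q 0 ℤ.≤_) (chain p q)
    chain-least p zero    = head-≤ (chain-sorted p zero)
    chain-least p (suc q) = head-≤ (chain-sorted p (suc q))

  segmentEnd≤width : ∀ p q → segmentEnd p q ≤ width p q r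
  segmentEnd≤width p zero    = ℕ.≤-refl
  segmentEnd≤width p (suc q) = subst (p ℕ.+ p ℕ.+ r ≤_) (width-minus p q r) (ℕ.m≤m+n _ _)

  segment-signedSums : ∀ p q → 1 ≤ r → 3 ≤ p ℕ.+ q →
                       All (SignedSum (p ℕ.+ q) (apFrom a d (p ℕ.+ q ℕ.+ r))) (segment p q)
  segment-signedSums p q 1≤r 3≤p+q = segment-all p q (λ s≤ → offset⇒signedSum d
    (offset-interval p q r (inj₁ 1≤r) (no-hole 3≤p+q) (ℕ.≤-trans s≤ (segmentEnd≤width p q))) a)
    where
    no-hole : ∀ {p q s} → 3 ≤ p ℕ.+ q → p ≡ 1 → q ≡ 1 → s ≢ suc r
    no-hole (s≤s (s≤s ())) refl refl

  chain-signedSums : ∀ {h} p q → p ℕ.+ q ≡ h → 3 ≤ h → 1 ≤ r →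
                     All (SignedSum h (apFrom a d (h ℕ.+ r))) (chain p q)
  chain-signedSums p zero    refl 3≤h 1≤r = segment-signedSums p 0 1≤r 3≤h
  chain-signedSums p (suc q) refl 3≤h 1≤r = All.++⁺ (segment-signedSums p (suc q) 1≤r 3≤h)
    (chain-signedSums (suc p) q (sym (ℕ.+-suc p q)) 3≤h 1≤r)

  private
    length-ring : ∀ p q r →
      suc (p ℕ.+ p ℕ.+ r) ℕ.+ (q ℕ.* (q ℕ.+ r) ℕ.+ (2 ℕ.* suc p ℕ.* q ℕ.+ (suc p ℕ.+ q) ℕ.* r) ℕ.+ 1)
      ≡ suc q ℕ.* (suc q ℕ.+ r) ℕ.+ (2 ℕ.* p ℕ.* suc q ℕ.+ (p ℕ.+ suc q) ℕ.* r) ℕ.+ 1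
    length-ring = ℕ-Solver.solve-∀

  length-segment : ∀ p q → length (segment p q) ≡ suc (segmentEnd p q)
  length-segment p q =
    trans (List.length-map (V p q) (upTo (suc (segmentEnd p q)))) (List.length-upTo (suc (segmentEnd p q)))

  length-chain : ∀ p q → length (chain p q) ≡ q ℕ.* (q ℕ.+ r) ℕ.+ width p q r ℕ.+ 1
  length-chain p zero    = trans (length-segment p 0) (ℕ.+-comm 1 (width p 0 r))
  length-chain p (suc q) = begin
    length (segment p (suc q) ++ chain (suc p) q)
      ≡⟨ List.length-++ (segment p (suc q)) ⟩
    length (segment p (suc q)) ℕ.+ length (chain (suc p) q)
      ≡⟨ cong₂ ℕ._+_ (length-segment p (suc q)) (length-chain (suc p) q) ⟩
    suc (p ℕ.+ p ℕ.+ r) ℕ.+ (q ℕ.* (q ℕ.+ r) ℕ.+ width (suc p) q r ℕ.+ 1)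
      ≡⟨ length-ring p q r ⟩
    suc q ℕ.* (suc q ℕ.+ r) ℕ.+ width p (suc q) r ℕ.+ 1
      ∎
    where open ≡-Reasoning

  private
    gap-ring : ∀ (V₀ d a : ℤ) → V₀ + d + + 2 * a ≡ V₀ + + 2 * a + d
    gap-ring = solve-∀

  gap-∉-chain : d ≢ + 2 * a → ∀ q → All (V 0 (suc (suc q)) (suc r) ≢_) (chain 0 (suc (suc q)))
  gap-∉-chain d≢2a q = All.++⁺
    (segment-all 0 (suc (suc q)) (λ s≤r → ≢-sym (ℤ.<⇒≢ (V-mono 0 (suc (suc q)) (s≤s s≤r)))))
    (between-∉ (chain-sorted 1 (suc q)) gap≢head gap<next)
    where
    V₀ : ℤ
    V₀ = V 0 (suc (suc q)) r
    gap≡ : V 0 (suc (suc q)) (suc r) ≡ V₀ + d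
    gap≡ = value-suc a d 0 (suc (suc q)) r r
    head≡ : V 1 (suc q) 0 ≡ V₀ + + 2 * a
    head≡ = value-flip a d 0 (suc q) r
    gap≢head : V 0 (suc (suc q)) (suc r) ≢ V 1 (suc q) 0
    gap≢head eq = d≢2a (+-cancelˡ V₀ d (+ 2 * a) (trans (sym gap≡) (trans eq head≡)))
    gap<next : V 0 (suc (suc q)) (suc r) < V 1 (suc q) 1
    gap<next = subst₂ _<_ (sym gap≡)
      (trans (gap-ring V₀ d a) (sym (trans (value-suc a d 1 (suc q) r 0) (cong (_+ d) head≡))))
      (i<i+j (V₀ + d) 0<2a)

  gap-signedSum : 1 ≤ r → ∀ q →
                  SignedSum (suc (suc q)) (apFrom a d (suc (suc q) ℕ.+ r)) (V 0 (suc (suc q)) (suc r))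
  gap-signedSum 1≤r q = offset⇒signedSum d (offset-interval 0 (suc (suc q)) r (inj₁ 1≤r) (λ ()) r<width) a
    where
    r<width : suc r ≤ r ℕ.+ (r ℕ.+ q ℕ.* r)
    r<width = ℕ.≤-trans (ℕ.+-monoˡ-≤ r 1≤r) (ℕ.+-monoʳ-≤ r (ℕ.m≤m+n r (q ℕ.* r)))

sumset : ℕ → ℤ → ℤ → ℕ → List ℤ
sumset h a d k = restrictedSignedSumset h (ap a d k)

signedSum⇒∈-sumset : ∀ {h k a d v} → SignedSum h (apFrom a d k) v → v ∈ sumset h a d k
signedSum⇒∈-sumset {h} {k} {a} {d} {v} σ =
  signedSum⇒∈ (subst (λ xs → SignedSum h xs v) (sym (ap≡apFrom a d k)) σ)

private
  chain-size : ∀ h r → h ℕ.* (h ℕ.+ r) ℕ.+ (2 ℕ.* 0 ℕ.* h ℕ.+ (0 ℕ.+ h) ℕ.* r) ℕ.+ 1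
                     ≡ h ℕ.* (h ℕ.+ 2 ℕ.* r) ℕ.+ 1
  chain-size = ℕ-Solver.solve-∀

module _ {a d : ℤ} (0<a : 0ℤ < a) (0<d : 0ℤ < d) {h r : ℕ} (3≤h : 3 ≤ h) (1≤r : 1 ≤ r) where
  open Chain 0<a 0<d r

  chain⊆sumset : chain 0 h ⊆ sumset h a d (h ℕ.+ r)
  chain⊆sumset v∈ = signedSum⇒∈-sumset (All.lookup (chain-signedSums 0 h refl 3≤h 1≤r) v∈)

  chain-unique : Unique (chain 0 h)
  chain-unique = AllPairs.map ℤ.<⇒≢ (chain-sorted 0 h)

  length-chain-0 : length (chain 0 h) ≡ spread h r ℕ.+ 1
  length-chain-0 = trans (length-chain 0 h) (chain-size h r)

  card-lower : spread h r ℕ.+ 1 ≤ card (sumset h a d (h ℕ.+ r))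
  card-lower = subst (_≤ card (sumset h a d (h ℕ.+ r))) length-chain-0
    (length≤card chain-unique chain⊆sumset)

card-lower-gap : ∀ {a d} (0<a : 0ℤ < a) (0<d : 0ℤ < d) {h r} → 3 ≤ h → 1 ≤ r → d ≢ + 2 * a →
                 spread h r ℕ.+ 2 ≤ card (sumset h a d (h ℕ.+ r))
card-lower-gap {a} {d} 0<a 0<d {h@(suc (suc q))} {r} 3≤h@(s≤s (s≤s _)) 1≤r d≢2a =
  subst (_≤ card (sumset h a d (h ℕ.+ r)))
    (trans (cong suc (length-chain-0 0<a 0<d 3≤h 1≤r)) (sym (ℕ.+-suc (spread h r) 1)))
    (length≤card (gap-∉-chain d≢2a q ∷ chain-unique 0<a 0<d 3≤h 1≤r) gap∷chain⊆sumset)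
  where
  open Chain 0<a 0<d r
  gap∷chain⊆sumset : V 0 h (suc r) ∷ chain 0 h ⊆ sumset h a d (h ℕ.+ r)
  gap∷chain⊆sumset (here refl) = signedSum⇒∈-sumset (gap-signedSum 1≤r q)
  gap∷chain⊆sumset (there v∈) = chain⊆sumset 0<a 0<d 3≤h 1≤r v∈

card-upper : ∀ a {h r} → card (sumset h a (+ 2 * a) (h ℕ.+ r)) ≤ spread h r ℕ.+ 1
card-upper a {h} {r} = subst (card (sumset h a (+ 2 * a) (h ℕ.+ r)) ≤_) length-candidates
  (card≤length sumset⊆candidates)
  where
  candidates : List ℤ
  candidates = map (λ j → a * (+ 2 * + j - + spread h r)) (upTo (suc (spread h r)))
  sumset⊆candidates : sumset h a (+ 2 * a) (h ℕ.+ r) ⊆ candidates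
  sumset⊆candidates v∈ with j , j≤ , refl ← signedSum-oddMultiple a
    (subst (λ xs → SignedSum h xs _) (ap≡apFrom a (+ 2 * a) (h ℕ.+ r)) (∈⇒signedSum v∈)) =
    ∈-map⁺ _ (∈-upTo⁺ (s≤s j≤))
  length-candidates : length candidates ≡ spread h r ℕ.+ 1
  length-candidates = trans (List.length-map _ (upTo (suc (spread h r))))
    (trans (List.length-upTo (suc (spread h r))) (ℕ.+-comm 1 (spread h r)))

extremal⇔ : ∀ {c n} {P : Set} → Dec P →
            (P → c ≤ n ℕ.+ 1) → (¬ P → n ℕ.+ 2 ≤ c) → n ℕ.+ 1 ≤ c → c ≡ n ℕ.+ 1 ⇔ P
extremal⇔ (yes p) upper _ lower = mk⇔ (λ _ → p) (λ p → ℕ.≤-antisym (upper p) lower)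
extremal⇔ {n = n} (no ¬p) _ lower-¬P _ = mk⇔
  (λ c≡ → ⊥-elim (2≰1 (ℕ.+-cancelˡ-≤ n 2 1 (subst (n ℕ.+ 2 ≤_) c≡ (lower-¬P ¬p)))))
  (λ p → ⊥-elim (¬p p))
  where
  2≰1 : ¬ 2 ≤ 1
  2≰1 (s≤s ())

private
  size-ring : ∀ h r → 2 ℕ.* h ℕ.* (h ℕ.+ r) ≡ h ℕ.* h ℕ.+ h ℕ.* (h ℕ.+ 2 ℕ.* r)
  size-ring = ℕ-Solver.solve-∀

2hk-h²≡spread : ∀ h r → 2 ℕ.* h ℕ.* (h ℕ.+ r) ∸ h ℕ.* h ≡ spread h r
2hk-h²≡spread h r = trans (cong (_∸ h ℕ.* h) (size-ring h r)) (ℕ.m+n∸m≡n (h ℕ.* h) _)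

corollary2p5 : (h k : ℕ) (a₁ d : ℤ) → 3 ≤ h → h ℕ.+ 1 ≤ k → + 0 < a₁ → + 0 < d →
    ((d ≡ + 2 * a₁ → card (restrictedSignedSumset h (ap a₁ d k)) ≥ (2 ℕ.* h ℕ.* k ∸ h ℕ.* h) ℕ.+ 1)
    × (d ≢ + 2 * a₁ → card (restrictedSignedSumset h (ap a₁ d k)) ≥ (2 ℕ.* h ℕ.* k ∸ h ℕ.* h) ℕ.+ 2)
    × (card (restrictedSignedSumset h (ap a₁ d k)) ≡ (2 ℕ.* h ℕ.* k ∸ h ℕ.* h) ℕ.+ 1 ⇔ d ≡ + 2 * a₁))
corollary2p5 h k a₁ d 3≤h h+1≤k 0<a 0<d
  with o , h+1+o≡k ← ℕ.m≤n⇒∃[o]m+o≡n h+1≤k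
  with refl ← trans (sym (ℕ.+-assoc h 1 o)) h+1+o≡k
  rewrite 2hk-h²≡spread h (suc o) =
  (λ _ → lower) , lower-gap , extremal⇔ (d ℤ.≟ + 2 * a₁) upper lower-gap lower
  where
  S : List ℤ
  S = sumset h a₁ d (h ℕ.+ suc o)
  upper : d ≡ + 2 * a₁ → card S ≤ spread h (suc o) ℕ.+ 1
  upper refl = card-upper a₁ {h} {suc o}
  lower : spread h (suc o) ℕ.+ 1 ≤ card S
  lower = card-lower 0<a 0<d 3≤h (s≤s z≤n)
  lower-gap : d ≢ + 2 * a₁ → spread h (suc o) ℕ.+ 2 ≤ card S
  lower-gap = card-lower-gap 0<a 0<d 3≤h (s≤s z≤n)
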